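{- The inequality $\min(c(G),c(G_{\min}))\le c(\mathcal{G})$ does not hold in general: there exists a periodic graph $\mathcal{G}$ with footprint $G$ such that $c(\mathcal{G})<\min(c(G),c(G_{\min}))$.
   Context: All graphs are finite, undirected and reflexive. A periodic graph with period $p\ge1$ is a sequence $\mathcal{G}=(G_0,\dots,G_{p-1})$ of graphs $G_i=(V,E_i)$ on a common vertex set, extended by $G_{i+p}=G_i$; its footprint is $G=(V,\bigcup_iE_i)$, assumed connected. Cops and Robber on a periodic graph with $k$ cops (perfect information): cops choose starting vertices, then the robber; in each round $t=0,1,\dots$ each cop moves to a vertex of $N_{G_{t\bmod p}}[\text{its position}]$, then the robber likewise; the cops win if a cop ever moves onto the robber's vertex. The cop number $c(\cdot)$ is the least $k$ such that $k$ cops have a winning strategy; a static graph is a periodic graph of period $1$. $c(G_{\min})=\min_{0\le i\le p-1}c(G_i)$. -}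

module Defs where

open import Data.Nat using (ℕ; zero; suc; _≤_)
open import Data.Nat.DivMod using (_mod_)
open import Data.Fin using (Fin; zero; suc; toℕ)
open import Data.Bool using (Bool; true; false; T; _∨_)
open import Data.Vec using (Vec; tabulate)
open import Data.Product using (Σ; ∃; _×_; _,_)
open import Relation.Binary.PropositionalEquality using (_≡_)

record Graph (n : ℕ) : Set where
  field
    adj      : Fin n → Fin n → Bool
    adj-refl : ∀ v → T (adj v v)
    adj-sym  : ∀ u v → adj u v ≡ adj v u
open Graph public

-- A periodic graph with period p = suc pred-period ≥ 1 on the common
-- vertex set Fin n: the graphs G_0 … G_{p-1}, extended by G_{i+p} = G_i.
record PeriodicGraph (n : ℕ) : Set where
  field
    pred-period : ℕ
    graphAt     : Fin (suc pred-period) → Graph n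
open PeriodicGraph public

period : ∀ {n} → PeriodicGraph n → ℕ
period 𝒢 = suc (pred-period 𝒢)

roundGraph : ∀ {n} → (𝒢 : PeriodicGraph n) → ℕ → Graph n
roundGraph 𝒢 t = graphAt 𝒢 (t mod period 𝒢)

anyFin : ∀ {p} → (Fin p → Bool) → Bool
anyFin {zero}  f = false
anyFin {suc p} f = f zero ∨ anyFin (λ i → f (suc i))

private
  ∨-introˡ : ∀ a b → T a → T (a ∨ b)
  ∨-introˡ true b _ = _

  anyFin-zero : ∀ {p} (f : Fin (suc p) → Bool) → T (f zero) → T (anyFin f)
  anyFin-zero f h = ∨-introˡ (f zero) _ h

  ∨-comm : ∀ a b → (a ∨ b) ≡ (b ∨ a)
  ∨-comm true  true  = _≡_.refl
  ∨-comm true  false = _≡_.refl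
  ∨-comm false true  = _≡_.refl
  ∨-comm false false = _≡_.refl

  anyFin-cong : ∀ {n p} (f g : Fin p → Fin n → Fin n → Bool) →
                (∀ i u v → f i u v ≡ g i v u) →
                ∀ u v → anyFin (λ i → f i u v) ≡ anyFin (λ i → g i v u)
  anyFin-cong {p = zero}  f g h u v = _≡_.refl
  anyFin-cong {p = suc p} f g h u v
    rewrite h zero u v
          | anyFin-cong (λ i → f (suc i)) (λ i → g (suc i)) (λ i → h (suc i)) u v
    = _≡_.refl

footprint : ∀ {n} → PeriodicGraph n → Graph n
footprint 𝒢 = record
  { adj      = λ u v → anyFin (λ i → adj (graphAt 𝒢 i) u v)
  ; adj-refl = λ v → anyFin-zero (λ i → adj (graphAt 𝒢 i) v v) (adj-refl (graphAt 𝒢 zero) v)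
  ; adj-sym  = anyFin-cong (λ i → adj (graphAt 𝒢 i)) (λ i → adj (graphAt 𝒢 i))
                 (λ i u v → adj-sym (graphAt 𝒢 i) u v)
  }

static : ∀ {n} → Graph n → PeriodicGraph n
static G = record { pred-period = 0 ; graphAt = λ _ → G }

data Reach {n : ℕ} (G : Graph n) : Fin n → Fin n → Set where
  here : ∀ {v} → Reach G v v
  step : ∀ {u w v} → T (adj G u w) → Reach G w v → Reach G u v

Connected : ∀ {n} → Graph n → Set
Connected {n} G = ∀ (u v : Fin n) → Reach G u v

Cops : ℕ → ℕ → Set
Cops k n = Fin k → Fin n

-- A (deterministic, perfect-information) strategy for k cops:
-- a starting placement, and for each round t a move computed from the
-- robber's positions r_0 … r_t so far (the cops' own past positions are
-- determined by these, so this loses no generality).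
record CopStrategy (k n : ℕ) : Set where
  field
    start : Cops k n
    move  : (t : ℕ) → Vec (Fin n) (suc t) → Cops k n
open CopStrategy public

-- Cop positions before round t (i.e. after round t-1), given the robber's
-- position sequence r (r 0 = robber's start, r (suc t) = position after round t).
copPos : ∀ {k n} → CopStrategy k n → (ℕ → Fin n) → ℕ → Cops k n
copPos σ r zero    = start σ
copPos σ r (suc t) = move σ t (tabulate (λ i → r (toℕ i)))

LegalCops : ∀ {k n} → PeriodicGraph n → CopStrategy k n → Set
LegalCops 𝒢 σ = ∀ r t i →
  T (adj (roundGraph 𝒢 t) (copPos σ r t i) (copPos σ r (suc t) i))

LegalRobber : ∀ {n} → PeriodicGraph n → (ℕ → Fin n) → Set
LegalRobber 𝒢 r = ∀ t → T (adj (roundGraph 𝒢 t) (r t) (r (suc t)))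

-- Capture in round T: after the cops' move in round T some cop is on the
-- robber's vertex r T.
CaughtAt : ∀ {k n} → CopStrategy k n → (ℕ → Fin n) → ℕ → Set
CaughtAt σ r T = ∃ λ i → copPos σ r (suc T) i ≡ r T

CopsWin : ∀ {n} → ℕ → PeriodicGraph n → Set
CopsWin {n} k 𝒢 = Σ (CopStrategy k n) λ σ →
  LegalCops 𝒢 σ × (∀ (r : ℕ → Fin n) → LegalRobber 𝒢 r → ∃ λ T → CaughtAt σ r T)

{-# OPTIONS --safe #-}
-- The periodic graph alternates between G₀, the path 0 – 1 – 2 with 3 isolated,
-- and G₁, the path 0 – 3 – 2 with 1 isolated, so its footprint is the 4-cycle
-- 0 – 1 – 2 – 3 – 0. One cop starting on 1 wins: in round 0 it can step onto any
-- vertex of the path of G₀, and a robber on 3 cannot leave during round 0, so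
-- the cop waits on 2 and catches him in round 1 along the edge 2 – 3 of G₁.
-- Against one cop on a fixed graph the robber only has to react to where the
-- cop stands: on the 4-cycle he stays antipodal to the cop, and on a graph with
-- an isolated vertex he sits on it unless the cop is there.
module Submission where

open import Defs
open import Data.Nat using (ℕ; _≤_)
open import Data.Fin using (Fin)
open import Data.Product using (Σ; _×_)
open import Relation.Nullary using (¬_)

open import Data.Nat using (zero; suc; s≤s)
open import Data.Fin using (zero; suc; toℕ; fromℕ; inject₁; _≟_)
open import Data.Fin.Patterns using (0F; 1F; 2F; 3F)
open import Data.Fin.Properties using (toℕ-fromℕ; toℕ-inject₁; all?)
open import Data.Bool using (Bool; true; false; T; _∨_)
open import Data.Bool.Properties using (∨-comm; T-∨)
open import Data.Empty using (⊥-elim)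
open import Data.Unit using (tt)
open import Data.Vec using (Vec; _∷_; _∷ʳ_; [_]; head; last; tabulate)
open import Data.Vec.Properties using (last-∷ʳ; tabulate-cong)
open import Data.Product using (_,_; ∃)
open import Data.Sum using (_⊎_; inj₁; inj₂)
open import Function using (_∘_; _$_)
open import Function.Bundles using (Equivalence)
open import Relation.Binary.PropositionalEquality
  using (_≡_; _≢_; refl; sym; trans; cong; cong₂; subst; subst₂; module ≡-Reasoning)
open import Relation.Nullary using (yes; no; _→-dec_)
open import Relation.Nullary.Decidable using (⌊_⌋; T?; toWitness; fromWitness)

private
  variable
    k n : ℕ

⌊≟⌋-sym : (u v : Fin n) → ⌊ u ≟ v ⌋ ≡ ⌊ v ≟ u ⌋
⌊≟⌋-sym u v with u ≟ v | v ≟ u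
... | yes _   | yes _   = refl
... | no  _   | no  _   = refl
... | yes u≡v | no  v≢u = ⊥-elim (v≢u (sym u≡v))
... | no  u≢v | yes v≡u = ⊥-elim (u≢v (sym v≡u))

undirected : (Fin n → Fin n → Bool) → Graph n
undirected E = record
  { adj      = λ u v → ⌊ u ≟ v ⌋ ∨ (E u v ∨ E v u)
  ; adj-refl = λ v → Equivalence.from T-∨ (inj₁ (fromWitness {a? = v ≟ v} refl))
  ; adj-sym  = λ u v → cong₂ _∨_ (⌊≟⌋-sym u v) (∨-comm (E u v) (E v u))
  }

Reach-trans : {G : Graph n} {u v w : Fin n} → Reach G u v → Reach G v w → Reach G u w
Reach-trans here       q = q
Reach-trans (step e p) q = step e (Reach-trans p q)

Reach-sym : {G : Graph n} {u v : Fin n} → Reach G u v → Reach G v u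
Reach-sym             here                 = here
Reach-sym {G = G} {u} (step {w = w} e p) =
  Reach-trans (Reach-sym p) (step (subst T (adj-sym G u w) e) here)

connected-via : (G : Graph n) (x : Fin n) → (∀ v → Reach G v x) → Connected G
connected-via G x toX u v = Reach-trans (toX u) (Reach-sym (toX v))

tabulate-∷ʳ : ∀ {A : Set} {m} (f : Fin (suc m) → A) →
              tabulate f ≡ tabulate (f ∘ inject₁) ∷ʳ f (fromℕ m)
tabulate-∷ʳ {m = zero}  f = refl
tabulate-∷ʳ {m = suc m} f = cong (f zero ∷_) (tabulate-∷ʳ (f ∘ suc))

CopMove : Graph n → Cops k n → Cops k n → Set
CopMove G c c′ = ∀ i → T (adj G (c i) (c′ i))

-- The play of a robber who answers the cops' positions with ρ. It is built
-- prefix by prefix because each cop move depends on the robber's history.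
module ReactivePlay (σ : CopStrategy k n) (ρ : Cops k n → Fin n) where

  history : (t : ℕ) → Vec (Fin n) (suc t)
  history zero    = [ ρ (start σ) ]
  history (suc t) = history t ∷ʳ ρ (move σ t (history t))

  play : ℕ → Fin n
  play t = last (history t)

  play-suc : ∀ t → play (suc t) ≡ ρ (move σ t (history t))
  play-suc t = last-∷ʳ _ (history t)

  history-tabulate : ∀ t → history t ≡ tabulate (play ∘ toℕ)
  history-tabulate zero    = refl
  history-tabulate (suc t) = begin
    history t ∷ʳ ρ (move σ t (history t))
      ≡⟨ cong₂ _∷ʳ_ (history-tabulate t) (sym (play-suc t)) ⟩
    tabulate (play ∘ toℕ) ∷ʳ play (suc t)
      ≡⟨ cong₂ _∷ʳ_ (tabulate-cong (cong play ∘ sym ∘ toℕ-inject₁))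
                    (cong play (sym (toℕ-fromℕ (suc t)))) ⟩
    tabulate (play ∘ toℕ ∘ inject₁) ∷ʳ play (toℕ (fromℕ (suc t)))
      ≡⟨ sym (tabulate-∷ʳ (play ∘ toℕ)) ⟩
    tabulate (play ∘ toℕ) ∎
    where open ≡-Reasoning

  play-reacts : ∀ t → play t ≡ ρ (copPos σ play t)
  play-reacts zero    = refl
  play-reacts (suc t) = trans (play-suc t) (cong (ρ ∘ move σ t) (history-tabulate t))

robber-escapes : (G : Graph n) (ρ : Cops k n → Fin n) →
                 (∀ c c′ → CopMove G c c′ → T (adj G (ρ c) (ρ c′))) →
                 (∀ c c′ → CopMove G c c′ → ∀ i → c′ i ≢ ρ c) →
                 ¬ CopsWin k (static G)
robber-escapes G ρ follows safe (σ , legal , wins) =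
  let T , i , caught = wins play robber-legal
  in safe _ _ (legal play T) i (trans caught (play-reacts T))
  where
  open ReactivePlay σ ρ
  robber-legal : LegalRobber (static G) play
  robber-legal t = subst₂ (λ a b → T (adj G a b)) (sym (play-reacts t)) (sym (play-reacts (suc t)))
                     (follows _ _ (legal play t))

¬CopsWin-0 : (G : Graph n) → Fin n → ¬ CopsWin 0 (static G)
¬CopsWin-0 G v = robber-escapes G (λ _ → v) (λ _ _ _ → adj-refl G v) (λ _ _ _ ())

¬CopsWin-≤1 : (G : Graph n) → Fin n → ¬ CopsWin 1 (static G) →
              ∀ j → j ≤ 1 → ¬ CopsWin j (static G)
¬CopsWin-≤1 G v _     zero          _         = ¬CopsWin-0 G v
¬CopsWin-≤1 G _ lose1 (suc zero)    _         = lose1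
¬CopsWin-≤1 G _ _     (suc (suc _)) (s≤s ())

Isolated : Graph n → Fin n → Set
Isolated G x = ∀ z → T (adj G x z) → z ≡ x

module _ (G : Graph n) {x : Fin n} (isolated : Isolated G x) (y : Fin n) (y≢x : y ≢ x) where

  private
    away : Fin n → Fin n
    away c with c ≟ x
    ... | yes _ = y
    ... | no  _ = x

    away-steady : ∀ c c′ → T (adj G c c′) → away c ≡ away c′
    away-steady c c′ e with c ≟ x | c′ ≟ x
    ... | yes _   | yes _    = refl
    ... | no  _   | no  _    = refl
    ... | yes refl | no c′≢x = ⊥-elim (c′≢x (isolated c′ e))
    ... | no  c≢x  | yes refl = ⊥-elim (c≢x (isolated c (subst T (adj-sym G c x) e)))

    away-safe : ∀ c c′ → T (adj G c c′) → c′ ≢ away c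
    away-safe c c′ e c′≡away with c ≟ x
    ... | yes refl = y≢x (trans (sym c′≡away) (isolated c′ e))
    ... | no  c≢x  = c≢x (isolated c (subst T (adj-sym G c x) (subst (λ z → T (adj G c z)) c′≡away e)))

  isolated⇒¬CopsWin-1 : ¬ CopsWin 1 (static G)
  isolated⇒¬CopsWin-1 = robber-escapes G (away ∘ (_$ 0F))
    (λ c c′ m → subst (λ z → T (adj G (away (c 0F)) z)) (away-steady _ _ (m 0F)) (adj-refl G _))
    (λ { c c′ m 0F → away-safe _ _ (m 0F) ; _ _ _ (suc ()) })

E₀ E₁ : Fin 4 → Fin 4 → Bool
E₀ 0F 1F = true
E₀ 1F 2F = true
E₀ _  _  = false
E₁ 0F 3F = true
E₁ 3F 2F = true
E₁ _  _  = false

G₀ G₁ : Graph 4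
G₀ = undirected E₀
G₁ = undirected E₁

𝒢 : PeriodicGraph 4
𝒢 = record { pred-period = 1 ; graphAt = λ { 0F → G₀ ; 1F → G₁ } }

C₄ : Graph 4
C₄ = footprint 𝒢

C₄-connected : Connected C₄
C₄-connected = connected-via C₄ 0F λ
  { 0F → here
  ; 1F → step tt here
  ; 2F → step {w = 1F} tt (step tt here)
  ; 3F → step tt here
  }

3-isolated-in-G₀ : Isolated G₀ 3F
3-isolated-in-G₀ = λ { 0F () ; 1F () ; 2F () ; 3F _ → refl }

1-isolated-in-G₁ : Isolated G₁ 1F
1-isolated-in-G₁ = λ { 0F () ; 1F _ → refl ; 2F () ; 3F () }

antipode : Fin 4 → Fin 4
antipode 0F = 2F
antipode 1F = 3F
antipode 2F = 0F
antipode 3F = 1F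

antipode-preserves-adj : ∀ u v → T (adj C₄ u v) → T (adj C₄ (antipode u) (antipode v))
antipode-preserves-adj = toWitness
  {a? = all? λ u → all? λ v → T? (adj C₄ u v) →-dec T? (adj C₄ (antipode u) (antipode v))} tt

antipode-nonadjacent : ∀ u → ¬ T (adj C₄ u (antipode u))
antipode-nonadjacent = toWitness {a? = all? λ u → T? (adj C₄ u (antipode u)) →-dec no λ ()} tt

¬CopsWin-1-C₄ : ¬ CopsWin 1 (static C₄)
¬CopsWin-1-C₄ = robber-escapes C₄ (antipode ∘ (_$ 0F))
  (λ c c′ m → antipode-preserves-adj (c 0F) (c′ 0F) (m 0F))
  (λ { c c′ m 0F c′≡ → antipode-nonadjacent (c 0F) (subst (λ z → T (adj C₄ (c 0F) z)) c′≡ (m 0F))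
     ; _ _ _ (suc ()) })

firstMove : Fin 4 → Fin 4
firstMove 3F = 2F
firstMove v  = v

-- Moves in round t ≥ 1 depend only on the robber's start, so they are legal
-- even against robber sequences that are not legal plays.
ambush : CopStrategy 1 4
ambush = record
  { start = λ _ → 1F
  ; move  = λ { zero rs _ → firstMove (head rs) ; (suc _) rs _ → head rs }
  }

ambush-legal : LegalCops 𝒢 ambush
ambush-legal r 0             0F = firstMove-in-G₀ (r 0)
  where
  firstMove-in-G₀ : ∀ v → T (adj G₀ 1F (firstMove v))
  firstMove-in-G₀ = λ { 0F → tt ; 1F → tt ; 2F → tt ; 3F → tt }
ambush-legal r 1             0F = firstMove-in-G₁ (r 0)
  where
  firstMove-in-G₁ : ∀ v → T (adj G₁ (firstMove v) v)
  firstMove-in-G₁ = λ { 0F → tt ; 1F → tt ; 2F → tt ; 3F → tt }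
ambush-legal r (suc (suc t)) 0F = adj-refl (roundGraph 𝒢 (suc (suc t))) (r 0)

firstMove-catches : ∀ v → firstMove v ≡ v ⊎ v ≡ 3F
firstMove-catches = λ { 0F → inj₁ refl ; 1F → inj₁ refl ; 2F → inj₁ refl ; 3F → inj₂ refl }

ambush-wins : CopsWin 1 𝒢
ambush-wins = ambush , ambush-legal , catch
  where
  catch : ∀ r → LegalRobber 𝒢 r → ∃ λ T → CaughtAt ambush r T
  catch r legal with firstMove-catches (r 0)
  ... | inj₁ caught = 0 , 0F , caught
  ... | inj₂ r₀≡3   = 1 , 0F , trans r₀≡3 (sym (3-isolated-in-G₀ (r 1) stuck))
    where
    stuck : T (adj G₀ 3F (r 1))
    stuck = subst (λ v → T (adj G₀ v (r 1))) r₀≡3 (legal 0)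

theorem5 : Σ ℕ λ n → Σ (PeriodicGraph n) λ 𝒢 →
    Connected (footprint 𝒢) × Σ ℕ λ k →
    CopsWin k 𝒢
    × (∀ j → j ≤ k → ¬ CopsWin j (static (footprint 𝒢)))
    × (∀ (i : Fin (period 𝒢)) j → j ≤ k → ¬ CopsWin j (static (graphAt 𝒢 i)))
theorem5 = 4 , 𝒢 , C₄-connected , 1 , ambush-wins
  , ¬CopsWin-≤1 C₄ 0F ¬CopsWin-1-C₄
  , λ { 0F → ¬CopsWin-≤1 G₀ 0F (isolated⇒¬CopsWin-1 G₀ 3-isolated-in-G₀ 0F λ ())
      ; 1F → ¬CopsWin-≤1 G₁ 0F (isolated⇒¬CopsWin-1 G₁ 1-isolated-in-G₁ 0F λ ()) }
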